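{- Let $n \geq 2$ be an integer and let $p$ be the smallest prime divisor of $n$. If $\frac{n}{p}$ has fewer than $p$ distinct prime divisors, then $n$ is nice.
   Context: Two congruences $a \pmod{b}$ and $a' \pmod{b'}$ overlap if there is an integer $x$ with $x \equiv a \pmod{b}$ and $x \equiv a' \pmod{b'}$. A finite set of congruences $\{a_1 \pmod{d_1}, \ldots, a_t \pmod{d_t}\}$ with pairwise distinct moduli $1 \leq d_1 < \cdots < d_t$ is called good if whenever two distinct congruences $a_i \pmod{d_i}$ and $a_j \pmod{d_j}$ of the set overlap, we have $\gcd(d_i,d_j)=1$. A positive integer $n$ is called nice if there exist integers $a_d$, one for each divisor $d$ of $n$ with $d>1$, such that $\{a_d \pmod{d} : d \mid n, d>1\}$ is a good set of congruences. -}

module Defs where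

open import Data.Nat using (ℕ; _<_; _≤_; _*_; suc)
open import Data.Nat.Divisibility using (_∣_; _∣?_)
open import Data.Nat.GCD using (gcd)
open import Data.Nat.Primality using (Prime; prime?)
open import Data.Integer as ℤ using (ℤ; +_; _-_)
import Data.Integer.Divisibility.Signed as ℤD
open import Data.List using (List; length; filter; upTo)
open import Data.Product using (Σ; ∃; _×_)
open import Relation.Binary.PropositionalEquality using (_≡_; _≢_)
open import Relation.Nullary.Decidable using (_×-dec_)

Overlap : ℤ → ℕ → ℤ → ℕ → Set
Overlap a b a' b' = ∃ λ (x : ℤ) → ((+ b) ℤD.∣ (x - a)) × ((+ b') ℤD.∣ (x - a'))

-- The family is given as a function ℕ → ℤ; only its values at divisors d > 1 matter.
Nice : ℕ → Set
Nice n = Σ (ℕ → ℤ) λ a →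
  ∀ d d' → d ∣ n → d' ∣ n → 1 < d → 1 < d' → d ≢ d' →
  Overlap (a d) d (a d') d' → gcd d d' ≡ 1

-- number of distinct prime divisors of m (for m ≥ 1 all such primes are ≤ m)
ω : ℕ → ℕ
ω m = length (filter (λ q → prime? q ×-dec (q ∣? m)) (upTo (suc m)))

SmallestPrimeDivisor : ℕ → ℕ → Set
SmallestPrimeDivisor p n = Prime p × p ∣ n × (∀ q → Prime q → q ∣ n → p ≤ q)

{-# OPTIONS --safe #-}
-- Number the prime factors of n increasingly. For a divisor d with prime
-- factor r let label d r ∈ [1, ω n] be one plus the index of the cyclic
-- predecessor of r among the prime factors of d, let cofactor r = n / r ^ v_r(n),
-- and put
--   a_d = Σ_{q prime, q ∣ d} cofactor q · q ^ (v_q(d) - 1) · label d q,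
-- so that a_d ≡ cofactor r · r ^ (v_r(d) - 1) · label d r modulo r ^ v_r(n),
-- the other terms being divisible by it. Let a_d and a_d′ overlap and the
-- prime r divide d and d′. Reducing modulo r ^ min(v_r(d), v_r(d′)) and
-- cancelling, if v_r(d) < v_r(d′) then r divides label d r, impossible since
-- then r² ∣ n and label d r ≤ ω n < r; so the valuations agree, and then r
-- divides the difference of the labels, which is smaller than ω n ≤ r, so the
-- labels agree. Thus d and d′ have the same cyclic predecessor at every common
-- prime factor, hence the same prime factors, and with equal valuations d = d′.
-- The hypothesis on p gives ω n ≤ ω m + 1 ≤ p ≤ r for every prime r ∣ n, and
-- ω n < r when r² ∣ n (for r = p because then p ∣ m and ω n = ω m).
module Submission where

open import Defs
open import Data.Nat using (ℕ; _<_; _≤_; _*_)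
open import Relation.Binary.PropositionalEquality using (_≡_)

open import Data.Nat.Base
open import Data.Nat.Properties
open import Data.Nat.Divisibility
open import Data.Nat.Coprimality using (Coprime; coprime-divisor)
open import Data.Nat.GCD using (gcd; gcd[m,n]∣m; gcd[m,n]∣n; gcd[m,n]≢0; gcd-greatest)
open import Data.Nat.Primality
open import Data.Nat.Primality.Factorisation using (factorise)
open import Data.Nat.ListAction using (product)
open import Data.Nat.Induction using (<-wellFounded)
open import Data.Integer.Base as ℤ using (ℤ; +_; 0ℤ)
import Data.Integer.Properties as ℤ
import Data.Integer.Divisibility.Signed as ℤ∣
import Data.Integer.Tactic.RingSolver as ℤ-Ring
import Data.Nat.Tactic.RingSolver as ℕ-Ring
open import Data.List.Base using ([]; _∷_; [_]; _++_; length; filter; upTo)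
open import Data.List.Properties using (filter-++; length-++; upTo-∷ʳ)
open import Data.List.Relation.Unary.All using (_∷_)
open import Data.Maybe.Base using (Maybe; just; nothing; fromMaybe)
open import Data.Product.Base using (∃-syntax; _×_; _,_)
import Data.Product.Base as Product
open import Data.Sum.Base using (_⊎_; inj₁; inj₂; [_,_]′)
open import Function.Base using (_∘_; id)
open import Induction.WellFounded using (Acc; acc)
open import Level using (Level)
open import Relation.Binary.Definitions using (tri<; tri≈; tri>)
open import Relation.Binary.PropositionalEquality
  using (refl; sym; trans; cong; cong₂; subst; subst₂; _≢_; module ≡-Reasoning)
open import Relation.Nullary.Decidable using (yes; no; _×-dec_)
open import Relation.Nullary.Negation using (¬_; contradiction)
open import Relation.Unary using (Pred; Decidable; _⊆_)

private
  variable
    ℓ ℓ′ : Level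
    a d d′ j k m q r x y L : ℕ

module _ {P : Pred ℕ ℓ} (P? : Decidable P) where

  greatestBelow : ℕ → Maybe ℕ
  greatestBelow zero = nothing
  greatestBelow (suc r) with P? r
  ... | yes _ = just r
  ... | no  _ = greatestBelow r

  data GreatestBelow (r : ℕ) : Maybe ℕ → Set ℓ where
    none : (∀ {z} → z < r → ¬ P z) → GreatestBelow r nothing
    some : y < r → P y → (∀ {z} → y < z → z < r → ¬ P z) → GreatestBelow r (just y)

  greatestBelow-spec : ∀ r → GreatestBelow r (greatestBelow r)
  greatestBelow-spec zero = none λ ()
  greatestBelow-spec (suc r) with P? r
  ... | yes Pr = some ≤-refl Pr λ r<z z<1+r _ → <⇒≱ r<z (s≤s⁻¹ z<1+r)
  ... | no ¬Pr = extend (greatestBelow-spec r)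
    where
    extend : ∀ {res} → GreatestBelow r res → GreatestBelow (suc r) res
    extend (none ¬P) = none λ z<1+r → [ ¬P , (λ { refl → ¬Pr }) ]′ (m<1+n⇒m<n∨m≡n z<1+r)
    extend (some y<r Py above) =
      some (m<n⇒m<1+n y<r) Py λ y<z z<1+r → [ above y<z , (λ { refl → ¬Pr }) ]′ (m<1+n⇒m<n∨m≡n z<1+r)

  greatestBelow-≥ : ∀ {r y} → GreatestBelow r (just y) → P x → x < r → x ≤ y
  greatestBelow-≥ (some _ _ above) Px x<r = ≮⇒≥ λ y<x → above y<x x<r Px

  -- The greatest element of P below r or, wrapping around, the greatest one
  -- below K (junk value 0 if P has none below K).
  cyclicPred : ℕ → ℕ → ℕ
  cyclicPred K r = fromMaybe (fromMaybe 0 (greatestBelow K)) (greatestBelow r)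

  cyclicPred-∈ : ∀ {K} → P x → x < K → ∀ r → P (cyclicPred K r)
  cyclicPred-∈ {K = K} Px x<K r with greatestBelow r | greatestBelow-spec r
  ... | just _  | some _ Py _ = Py
  ... | nothing | none _ with greatestBelow K | greatestBelow-spec K
  ...   | just _  | some _ Py _ = Py
  ...   | nothing | none ¬P = contradiction Px (¬P x<K)

  cyclicPred-greatest : ∀ K {r} → P x → x < r →
                        cyclicPred K r < r × P (cyclicPred K r) × x ≤ cyclicPred K r
  cyclicPred-greatest K {r} Px x<r with greatestBelow r | greatestBelow-spec r
  ... | just _  | spec@(some y<r Py _) = y<r , Py , greatestBelow-≥ spec Px x<r
  ... | nothing | none ¬P = contradiction Px (¬P x<r)

  cyclicPred-wrap : ∀ K {r} → (∀ {z} → z < r → ¬ P z) → P x → x < K → x ≤ cyclicPred K r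
  cyclicPred-wrap K {r} ¬P<r Px x<K with greatestBelow r | greatestBelow-spec r
  ... | just _  | some y<r Py _ = contradiction Py (¬P<r y<r)
  ... | nothing | none _ with greatestBelow K | greatestBelow-spec K
  ...   | just _  | spec@(some _ _ _) = greatestBelow-≥ spec Px x<K
  ...   | nothing | none ¬P = contradiction Px (¬P x<K)

-- If r₀ lies in P and Q then, walking cyclically downwards through P from r₀,
-- agreement of the cyclic predecessors keeps every visited element in Q, and
-- the walk visits all of P.
cyclicPred-≡⇒⊆ : ∀ {P : Pred ℕ ℓ} {Q : Pred ℕ ℓ′} (P? : Decidable P) (Q? : Decidable Q) {K} →
                 (∀ {x} → P x → x < K) → (∀ {x} → Q x → x < K) →
                 (∀ {r} → P r → Q r → cyclicPred P? K r ≡ cyclicPred Q? K r) →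
                 ∀ {r₀} → P r₀ → Q r₀ → P ⊆ Q
cyclicPred-≡⇒⊆ {P = P} {Q} P? Q? {K} P<K Q<K agree {r₀} Pr₀ Qr₀ {x} Px =
  within-top (top-common (<-wellFounded r₀) Pr₀ Qr₀)
  where
  pred-common : P r → Q r → Q (cyclicPred P? K r)
  pred-common {r} Pr Qr = subst Q (sym (agree Pr Qr)) (cyclicPred-∈ Q? Qr (Q<K Qr) r)

  top-common : Acc _<_ r → P r → Q r → ∃[ t ] P t × Q t × (∀ {x} → P x → x ≤ t)
  top-common {r} (acc rec) Pr Qr with anyUpTo? P? r
  ... | yes (y , y<r , Py) =
    let c<r , Pc , _ = cyclicPred-greatest P? K Py y<r in top-common (rec c<r) Pc (pred-common Pr Qr)
  ... | no ∄y<r =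
    cyclicPred P? K r , cyclicPred-∈ P? Pr (P<K Pr) r , pred-common Pr Qr ,
    λ Px → cyclicPred-wrap P? K (λ z<r Pz → ∄y<r (_ , z<r , Pz)) Px (P<K Px)

  below-common : Acc _<_ r → P r → Q r → ∀ {x} → P x → x < r → Q x
  below-common {r} (acc rec) Pr Qr Px x<r with cyclicPred-greatest P? K Px x<r
  ... | c<r , Pc , x≤c with m≤n⇒m<n∨m≡n x≤c
  ...   | inj₁ x<c = below-common (rec c<r) Pc (pred-common Pr Qr) Px x<c
  ...   | inj₂ refl = pred-common Pr Qr

  within-top : ∃[ t ] P t × Q t × (∀ {x} → P x → x ≤ t) → Q x
  within-top (t , Pt , Qt , P≤t) with m≤n⇒m<n∨m≡n (P≤t Px)
  ... | inj₁ x<t = below-common (<-wellFounded t) Pt Qt Px x<t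
  ... | inj₂ refl = Qt

module _ {P : Pred ℕ ℓ} (P? : Decidable P) where

  count : ℕ → ℕ
  count zero = 0
  count (suc L) with P? L
  ... | yes _ = suc (count L)
  ... | no  _ = count L

  count-≤-suc : ∀ L → count L ≤ count (suc L)
  count-≤-suc L with P? L
  ... | yes _ = n≤1+n (count L)
  ... | no  _ = ≤-refl

  count-mono : ∀ {L L′} → L ≤ L′ → count L ≤ count L′
  count-mono {L′ = zero} z≤n = ≤-refl
  count-mono {L′ = suc L′} L≤1+L′ with m≤n⇒m<n∨m≡n L≤1+L′
  ... | inj₁ L<1+L′ = ≤-trans (count-mono (s≤s⁻¹ L<1+L′)) (count-≤-suc L′)
  ... | inj₂ refl   = ≤-refl

  count-< : P y → y < L → count y < count L
  count-< {y} Py y<L = ≤-trans (step Py) (count-mono y<L)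
    where
    step : P y → suc (count y) ≤ count (suc y)
    step Py with P? y
    ... | yes _  = ≤-refl
    ... | no ¬Py = contradiction Py ¬Py

  count-injective : P x → P y → count x ≡ count y → x ≡ y
  count-injective {x} {y} Px Py cx≡cy with <-cmp x y
  ... | tri< x<y _ _ = contradiction cx≡cy (<⇒≢ (count-< Px x<y))
  ... | tri≈ _ x≡y _ = x≡y
  ... | tri> _ _ y<x = contradiction (sym cx≡cy) (<⇒≢ (count-< Py y<x))

  count-beyond : (∀ {x} → P x → x < L) → ∀ {L′} → L ≤ L′ → count L′ ≡ count L
  count-beyond P<L {zero} z≤n = refl
  count-beyond P<L {suc L′} L≤1+L′ with m≤n⇒m<n∨m≡n L≤1+L′
  ... | inj₂ refl = refl
  ... | inj₁ L<1+L′ with P? L′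
  ...   | yes PL′ = contradiction (P<L PL′) (≤⇒≯ (s≤s⁻¹ L<1+L′))
  ...   | no  _   = count-beyond P<L (s≤s⁻¹ L<1+L′)

  length-filter-upTo : ∀ L → length (filter P? (upTo L)) ≡ count L
  length-filter-upTo zero = refl
  length-filter-upTo (suc L) = begin
    length (filter P? (upTo (suc L)))
      ≡⟨ cong (length ∘ filter P?) (upTo-∷ʳ L) ⟨
    length (filter P? (upTo L ++ [ L ]))
      ≡⟨ cong length (filter-++ P? (upTo L) [ L ]) ⟩
    length (filter P? (upTo L) ++ filter P? [ L ])
      ≡⟨ length-++ (filter P? (upTo L)) ⟩
    length (filter P? (upTo L)) + length (filter P? [ L ])
      ≡⟨ cong (_+ length (filter P? [ L ])) (length-filter-upTo L) ⟩
    count L + length (filter P? [ L ])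
      ≡⟨ last-step ⟩
    count (suc L)
      ∎
    where
    open ≡-Reasoning
    last-step : count L + length (filter P? [ L ]) ≡ count (suc L)
    last-step with P? L
    ... | yes _ = +-comm (count L) 1
    ... | no  _ = +-identityʳ (count L)

module _ {P : Pred ℕ ℓ} {Q : Pred ℕ ℓ′} (P? : Decidable P) (Q? : Decidable Q) where

  count-⊆ : (∀ {x} → x < L → P x → Q x) → count P? L ≤ count Q? L
  count-⊆ {zero} _ = z≤n
  count-⊆ {suc L} P⊆Q with P? L | Q? L | count-⊆ {L} (P⊆Q ∘ m<n⇒m<1+n)
  ... | yes _  | yes _  | IH = s≤s IH
  ... | yes PL | no ¬QL | _  = contradiction (P⊆Q (n<1+n L) PL) ¬QL
  ... | no  _  | yes _  | IH = m≤n⇒m≤1+n IH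
  ... | no  _  | no  _  | IH = IH

  count-⊆-insert : (∀ {x} → P x → Q x ⊎ x ≡ a) → ∀ L → count P? L ≤ suc (count Q? L)
  count-⊆-insert P⊆Q+a zero = z≤n
  count-⊆-insert {a} P⊆Q+a (suc L) with P? L | Q? L | count-⊆-insert P⊆Q+a L
  ... | yes _  | yes _  | IH = s≤s IH
  ... | yes PL | no ¬QL | _  = s≤s (count-⊆ below-L)
    where
    L≡a : L ≡ a
    L≡a = [ (λ QL → contradiction QL ¬QL) , id ]′ (P⊆Q+a PL)
    below-L : ∀ {x} → x < L → P x → Q x
    below-L x<L Px = [ id , (λ { refl → contradiction L≡a (>⇒≢ x<L) }) ]′ (P⊆Q+a Px)
  ... | no  _  | yes _  | IH = m≤n⇒m≤1+n IH
  ... | no  _  | no  _  | IH = IH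

PrimeFactor : ℕ → Pred ℕ _
PrimeFactor a q = Prime q × q ∣ a

primeFactor? : ∀ a → Decidable (PrimeFactor a)
primeFactor? a q = prime? q ×-dec q ∣? a

divisor-nonZero : .{{NonZero a}} → d ∣ a → NonZero d
divisor-nonZero {a} d∣a = ≢-nonZero λ { refl → ≢-nonZero⁻¹ a (0∣⇒≡0 d∣a) }

ω≡count : ∀ a .{{_ : NonZero a}} → a < L → ω a ≡ count (primeFactor? a) L
ω≡count a a<L = trans (length-filter-upTo (primeFactor? a) (suc a))
                      (sym (count-beyond (primeFactor? a) (λ (_ , q∣a) → s≤s (∣⇒≤ q∣a)) a<L))

ω-mono : ∀ a b .{{_ : NonZero a}} .{{_ : NonZero b}} → PrimeFactor a ⊆ PrimeFactor b → ω a ≤ ω b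
ω-mono a b a⊆b = begin
  ω a                                 ≡⟨ ω≡count a (m≤m+n (suc a) b) ⟩
  count (primeFactor? a) (suc a + b)
    ≤⟨ count-⊆ (primeFactor? a) (primeFactor? b) {L = suc a + b} (λ _ → a⊆b) ⟩
  count (primeFactor? b) (suc a + b) ≡⟨ ω≡count b (s≤s (m≤n+m b a)) ⟨
  ω b                                 ∎
  where open ≤-Reasoning

ω-insert : ∀ a b .{{_ : NonZero a}} .{{_ : NonZero b}} →
           (∀ {q} → PrimeFactor a q → PrimeFactor b q ⊎ q ≡ m) → ω a ≤ suc (ω b)
ω-insert a b a⊆b+m = begin
  ω a                                       ≡⟨ ω≡count a (m≤m+n (suc a) b) ⟩
  count (primeFactor? a) (suc a + b)
    ≤⟨ count-⊆-insert (primeFactor? a) (primeFactor? b) a⊆b+m (suc a + b) ⟩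
  suc (count (primeFactor? b) (suc a + b)) ≡⟨ cong suc (ω≡count b (s≤s (m≤n+m b a))) ⟨
  suc (ω b)                                 ∎
  where open ≤-Reasoning

prime∣prime⇒≡ : ∀ {p} → Prime p → Prime q → p ∣ q → p ≡ q
prime∣prime⇒≡ pp pq p∣q with prime⇒irreducible pq p∣q
... | inj₁ refl = contradiction pp ¬prime[1]
... | inj₂ p≡q  = p≡q

prime∣^⇒∣ : ∀ {p} → Prime p → p ∣ m ^ k → p ∣ m
prime∣^⇒∣ {k = zero}      pp p∣1      = contradiction (subst Prime (∣1⇒≡1 p∣1) pp) ¬prime[1]
prime∣^⇒∣ {m} {k = suc k} pp p∣m^1+k =
  [ id , prime∣^⇒∣ {k = k} pp ]′ (euclidsLemma m (m ^ k) pp p∣m^1+k)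

primeFactor-of-* : ∀ {p} → Prime p → PrimeFactor (p * m) q → PrimeFactor m q ⊎ q ≡ p
primeFactor-of-* {m} {p = p} pp (pq , q∣pm) =
  [ inj₂ ∘ prime∣prime⇒≡ pq pp , inj₁ ∘ (pq ,_) ]′ (euclidsLemma p m pq q∣pm)

ω[p*m]≤1+ω[m] : ∀ {p} m .{{_ : NonZero m}} → Prime p → ω (p * m) ≤ suc (ω m)
ω[p*m]≤1+ω[m] {p} m pp = ω-insert (p * m) m {{m*n≢0 p m {{prime⇒nonZero pp}}}} (primeFactor-of-* pp)

ω[p*m]≤ω[m] : ∀ {p} m .{{_ : NonZero m}} → Prime p → p ∣ m → ω (p * m) ≤ ω m
ω[p*m]≤ω[m] {p} m pp p∣m = ω-mono (p * m) m {{m*n≢0 p m {{prime⇒nonZero pp}}}} absorb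
  where
  absorb : PrimeFactor (p * m) ⊆ PrimeFactor m
  absorb q∈pm = [ id , (λ { refl → pp , p∣m }) ]′ (primeFactor-of-* pp q∈pm)

prime-divisor : ∀ {a} .{{_ : NonZero a}} → a ≢ 1 → ∃[ q ] PrimeFactor a q
prime-divisor {a} a≢1 with factorise a
... | record { factors = [] ; isFactorisation = a≡1 } = contradiction a≡1 a≢1
... | record { factors = q ∷ qs ; isFactorisation = a≡q*Πqs ; factorsPrime = pq ∷ _ } =
  q , pq , subst (q ∣_) (sym a≡q*Πqs) (m∣m*n (product qs))

coprime-prime-power : ∀ {p} → Prime p → Prime q → p ≢ q → Coprime (p ^ k) q
coprime-prime-power {k = k} pp pq p≢q (i∣p^k , i∣q) with prime⇒irreducible pq i∣q
... | inj₁ i≡1 = i≡1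
... | inj₂ refl = contradiction (sym (prime∣prime⇒≡ pq pp (prime∣^⇒∣ {k = k} pq i∣p^k))) p≢q

prime-power-∣-cancel : ∀ {p} → Prime p → Prime q → p ≢ q → p ^ j ∣ q ^ k * x → p ^ j ∣ x
prime-power-∣-cancel {k = zero} {x} _ _ _ h = subst (_ ∣_) (+-identityʳ x) h
prime-power-∣-cancel {q} {j} {k = suc k} {x} {p} pp pq p≢q h =
  prime-power-∣-cancel {j = j} {k = k} pp pq p≢q
    (coprime-divisor (coprime-prime-power {k = j} pp pq p≢q) (subst (p ^ j ∣_) (*-assoc q (q ^ k) x) h))

^-∣-mono : ∀ r → j ≤ k → r ^ j ∣ r ^ k
^-∣-mono {j} {k} r j≤k = subst (r ^ j ∣_) r^j*r^[k∸j]≡r^k (m∣m*n (r ^ (k ∸ j)))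
  where
  r^j*r^[k∸j]≡r^k : r ^ j * r ^ (k ∸ j) ≡ r ^ k
  r^j*r^[k∸j]≡r^k = trans (sym (^-distribˡ-+-* r j (k ∸ j))) (cong (r ^_) (m+[n∸m]≡n j≤k))

common-prime-factor : ∀ {d d′} .{{_ : NonZero d}} → gcd d d′ ≢ 1 →
                      ∃[ r ] PrimeFactor d r × PrimeFactor d′ r
common-prime-factor {d} {d′} g≢1
  with prime-divisor {{≢-nonZero (gcd[m,n]≢0 d d′ (inj₁ (≢-nonZero⁻¹ d)))}} g≢1
... | r , pr , r∣g = r , (pr , ∣-trans r∣g (gcd[m,n]∣m d d′)) , (pr , ∣-trans r∣g (gcd[m,n]∣n d d′))

-- At most k divisions by r; k = d is enough when r > 1, as each division decreases d.
valuation′ : ℕ → ℕ → ℕ → ℕ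
valuation′ r zero    d = 0
valuation′ r (suc k) d with r ∣? d
... | yes (divides q _) = suc (valuation′ r k q)
... | no  _             = 0

valuation : ℕ → ℕ → ℕ
valuation r d = valuation′ r d d

valuation′-∣ : ∀ r k d → r ^ valuation′ r k d ∣ d
valuation′-∣ r zero    d = 1∣ d
valuation′-∣ r (suc k) d with r ∣? d
... | yes (divides q refl) =
  subst (r * r ^ valuation′ r k q ∣_) (*-comm r q) (*-monoʳ-∣ r (valuation′-∣ r k q))
... | no  _                = 1∣ d

valuation′-∤ : ∀ r .{{_ : NonTrivial r}} k d .{{_ : NonZero d}} → d ≤ k →
               ¬ r ^ suc (valuation′ r k d) ∣ d
valuation′-∤ r zero d d≤0 = contradiction (n≤0⇒n≡0 d≤0) (≢-nonZero⁻¹ d)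
valuation′-∤ r (suc k) d d≤1+k with r ∣? d
... | no  r∤d              = r∤d ∘ subst (_∣ d) (*-identityʳ r)
... | yes (divides q refl) = valuation′-∤ r k q {{q≢0}} q≤k ∘ cancel-r
  where
  cancel-r : r ^ suc (suc (valuation′ r k q)) ∣ q * r → r ^ suc (valuation′ r k q) ∣ q
  cancel-r = *-cancelˡ-∣ r {{nonTrivial⇒nonZero r}} ∘ subst (r ^ suc (suc (valuation′ r k q)) ∣_) (*-comm q r)
  q≢0 : NonZero q
  q≢0 = m*n≢0⇒m≢0 q
  q≤k : q ≤ k
  q≤k = s≤s⁻¹ (≤-trans (m<m*n q r {{q≢0}} (nonTrivial⇒n>1 r)) d≤1+k)

valuation-∣ : ∀ r d → r ^ valuation r d ∣ d
valuation-∣ r d = valuation′-∣ r d d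

valuation-∤ : ∀ r .{{_ : NonTrivial r}} d .{{_ : NonZero d}} → ¬ r ^ suc (valuation r d) ∣ d
valuation-∤ r d = valuation′-∤ r d d ≤-refl

^∣⇒≤valuation : ∀ r .{{_ : NonTrivial r}} {d} .{{_ : NonZero d}} →
                r ^ k ∣ d → k ≤ valuation r d
^∣⇒≤valuation r {d} r^k∣d = ≮⇒≥ λ v<k → valuation-∤ r d (∣-trans (^-∣-mono r v<k) r^k∣d)

∣⇒valuation>0 : ∀ r .{{_ : NonTrivial r}} {d} .{{_ : NonZero d}} → r ∣ d → 0 < valuation r d
∣⇒valuation>0 r r∣d = ^∣⇒≤valuation r (subst (_∣ _) (sym (*-identityʳ r)) r∣d)

-- If d / gcd d d′ had a prime factor s, then s ^ (1 + valuation s d) would divide d.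
∣-by-valuations : ∀ {d d′} .{{_ : NonZero d}} →
                  (∀ {q} → Prime q → q ∣ d → q ^ valuation q d ∣ d′) → d ∣ d′
∣-by-valuations {d} {d′} powers∣d′ = via-gcd (gcd[m,n]∣m d d′)
  where
  via-gcd : gcd d d′ ∣ d → d ∣ d′
  via-gcd g∣d with quotient g∣d ≟ 1
  ... | yes a≡1 = subst (_∣ d′) (sym d≡g) (gcd[m,n]∣n d d′)
    where
    d≡g : d ≡ gcd d d′
    d≡g = trans (m∣n⇒n≡quotient*m g∣d) (trans (cong (_* gcd d d′) a≡1) (*-identityˡ _))
  ... | no a≢1 with prime-divisor {{quotient≢0 g∣d}} a≢1
  ...   | s , ps , s∣a = contradiction s^[1+v]∣d (valuation-∤ s {{prime⇒nonTrivial ps}} d)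
    where
    s^v∣g : s ^ valuation s d ∣ gcd d d′
    s^v∣g = gcd-greatest (valuation-∣ s d) (powers∣d′ ps (∣-trans s∣a (quotient-∣ g∣d)))
    s^[1+v]∣d : s ^ suc (valuation s d) ∣ d
    s^[1+v]∣d = subst (s ^ suc (valuation s d) ∣_) (sym (m∣n⇒n≡quotient*m g∣d)) (*-pres-∣ s∣a s^v∣g)

infix 4 _≡_[mod_]
_≡_[mod_] : ℤ → ℤ → ℕ → Set
x ≡ y [mod k ] = + k ℤ∣.∣ x ℤ.- y

≡-mod-sym : ∀ {x y} → x ≡ y [mod k ] → y ≡ x [mod k ]
≡-mod-sym {x = x} {y} k∣x-y = subst (_ ℤ∣.∣_) (negate x y) (ℤ∣.∣m⇒∣-m k∣x-y)
  where
  negate : ∀ x y → ℤ.- (x ℤ.- y) ≡ y ℤ.- x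
  negate = ℤ-Ring.solve-∀

≡-mod-trans : ∀ {x y z} → x ≡ y [mod k ] → y ≡ z [mod k ] → x ≡ z [mod k ]
≡-mod-trans {x = x} {y} {z} k∣x-y k∣y-z =
  subst (_ ℤ∣.∣_) (ℤ.+-minus-telescope x y z) (ℤ∣.∣m∣n⇒∣m+n k∣x-y k∣y-z)

≡-mod-∣ : ∀ {x y} → j ∣ k → x ≡ y [mod k ] → x ≡ y [mod j ]
≡-mod-∣ j∣k = ℤ∣.∣-trans (ℤ∣.∣ᵤ⇒∣ j∣k)

overlap⇒≡-mod : ∀ {x x′ b b′} → Overlap x b x′ b′ → k ∣ b → k ∣ b′ → x ≡ x′ [mod k ]
overlap⇒≡-mod {x = x} {x′} (y , b∣y-x , b′∣y-x′) k∣b k∣b′ =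
  ≡-mod-trans {x = x} {y} (≡-mod-sym {x = y} (to-mod k∣b b∣y-x)) (to-mod k∣b′ b′∣y-x′)
  where
  to-mod : ∀ {b z} → k ∣ b → + b ℤ∣.∣ y ℤ.- z → y ≡ z [mod k ]
  to-mod k∣b = ℤ∣.∣-trans (ℤ∣.∣ᵤ⇒∣ k∣b)

∑< : ℕ → (ℕ → ℤ) → ℤ
∑< zero    f = 0ℤ
∑< (suc L) f = ∑< L f ℤ.+ f L

∑<-∣ : ∀ {f} {c : ℤ} → (∀ {q} → q < L → c ℤ∣.∣ f q) → c ℤ∣.∣ ∑< L f
∑<-∣ {zero}  _     = ℤ∣.divides 0ℤ refl
∑<-∣ {suc L} c∣f = ℤ∣.∣m∣n⇒∣m+n (∑<-∣ (c∣f ∘ m<n⇒m<1+n)) (c∣f (n<1+n L))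

∑<-≡-mod : ∀ {f} → r < L → (∀ {q} → q < L → q ≢ r → + k ℤ∣.∣ f q) → ∑< L f ≡ f r [mod k ]
∑<-≡-mod {r} {suc L} {f = f} r<1+L others with m<1+n⇒m<n∨m≡n r<1+L
... | inj₂ refl = subst (_ ℤ∣.∣_) (sym (cancel (∑< L f) (f L)))
                        (∑<-∣ λ q<L → others (m<n⇒m<1+n q<L) (<⇒≢ q<L))
  where
  cancel : ∀ s t → (s ℤ.+ t) ℤ.- t ≡ s
  cancel = ℤ-Ring.solve-∀
... | inj₁ r<L  = subst (_ ℤ∣.∣_) (sym (shuffle (∑< L f) (f L) (f r)))
                        (ℤ∣.∣m∣n⇒∣m+n (∑<-≡-mod r<L (others ∘ m<n⇒m<1+n))
                                      (others (n<1+n L) (>⇒≢ r<L)))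
  where
  shuffle : ∀ s t u → (s ℤ.+ t) ℤ.- u ≡ (s ℤ.- u) ℤ.+ t
  shuffle = ℤ-Ring.solve-∀

pos-*-minus : ∀ a b c → + (a * b) ℤ.- + (a * c) ≡ + a ℤ.* (+ b ℤ.- + c)
pos-*-minus a b c = trans (cong₂ ℤ._-_ (ℤ.pos-* a b) (ℤ.pos-* a c)) (sym (distrib (+ a) (+ b) (+ c)))
  where
  distrib : ∀ x y z → x ℤ.* (y ℤ.- z) ≡ x ℤ.* y ℤ.- x ℤ.* z
  distrib = ℤ-Ring.solve-∀

prime-∤-cancelˡ : ∀ {r w z} → Prime r → ¬ r ∣ w → + r ℤ∣.∣ + w ℤ.* z → + r ℤ∣.∣ z
prime-∤-cancelˡ {r} {w} {z} pr r∤w r∣wz =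
  [ (λ r∣w → contradiction r∣w r∤w) , ℤ∣.∣ᵤ⇒∣ ]′
    (euclidsLemma w ℤ.∣ z ∣ pr (subst (r ∣_) (ℤ.abs-* (+ w) z) (ℤ∣.∣⇒∣ᵤ r∣wz)))

strip-power : ∀ {r W U U′ v v′} → Prime r → ¬ r ∣ W → 0 < v → v ≤ v′ →
              + (W * r ^ pred v * U) ≡ + (W * r ^ pred v′ * U′) [mod r ^ v ] →
              + U ≡ + (r ^ (v′ ∸ v) * U′) [mod r ]
strip-power {r} {W} {U} {U′} {suc c} {suc c′} pr r∤W _ (s≤s c≤c′) r^v∣diff =
  prime-∤-cancelˡ pr r∤W (ℤ∣.*-cancelˡ-∣ (+ (r ^ c)) {{m^n≢0 r c {{prime⇒nonZero pr}}}}
             (subst₂ ℤ∣._∣_ modulus difference r^v∣diff))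
  where
  gap : ℕ
  gap = c′ ∸ c
  modulus : + (r ^ suc c) ≡ + (r ^ c) ℤ.* + r
  modulus = trans (cong +_ (*-comm r (r ^ c))) (ℤ.pos-* (r ^ c) r)
  r^c′≡r^c*r^gap : r ^ c′ ≡ r ^ c * r ^ gap
  r^c′≡r^c*r^gap = trans (cong (r ^_) (sym (m+[n∸m]≡n c≤c′))) (^-distribˡ-+-* r c gap)
  difference : + (W * r ^ c * U) ℤ.- + (W * r ^ c′ * U′) ≡
               + (r ^ c) ℤ.* (+ W ℤ.* (+ U ℤ.- + (r ^ gap * U′)))
  difference = begin
    + (W * r ^ c * U) ℤ.- + (W * r ^ c′ * U′)
      ≡⟨ cong₂ (λ a b → + a ℤ.- + b) (reorder W (r ^ c) U)
               (trans (cong (λ t → W * t * U′) r^c′≡r^c*r^gap) (reorder₂ W (r ^ c) (r ^ gap) U′)) ⟩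
    + (r ^ c * (W * U)) ℤ.- + (r ^ c * (W * (r ^ gap * U′)))
      ≡⟨ pos-*-minus (r ^ c) (W * U) (W * (r ^ gap * U′)) ⟩
    + (r ^ c) ℤ.* (+ (W * U) ℤ.- + (W * (r ^ gap * U′)))
      ≡⟨ cong (+ (r ^ c) ℤ.*_) (pos-*-minus W U (r ^ gap * U′)) ⟩
    + (r ^ c) ℤ.* (+ W ℤ.* (+ U ℤ.- + (r ^ gap * U′)))
      ∎
    where
    open ≡-Reasoning
    reorder : ∀ w a u → w * a * u ≡ a * (w * u)
    reorder = ℕ-Ring.solve-∀
    reorder₂ : ∀ w a b u → w * (a * b) * u ≡ a * (w * (b * u))
    reorder₂ = ℕ-Ring.solve-∀

suc-≡-mod⇒≡ : ∀ {i j} → i < r → j < r → + suc i ≡ + suc j [mod r ] → i ≡ j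
suc-≡-mod⇒≡ {r} {i} {j} i<r j<r r∣diff =
  suc-injective (ℤ.+-injective (ℤ.i-j≡0⇒i≡j _ _ (ℤ.∣i∣≡0⇒i≡0 ∣diff∣≡0)))
  where
  ∣diff∣<r : ℤ.∣ + suc i ℤ.- + suc j ∣ < r
  ∣diff∣<r = begin-strict
    ℤ.∣ + suc i ℤ.- + suc j ∣
      ≡⟨ cong ℤ.∣_∣ (trans (ℤ.[+m]-[+n]≡m⊖n (suc i) (suc j)) (ℤ.[1+m]⊖[1+n]≡m⊖n i j)) ⟩
    ℤ.∣ i ℤ.⊖ j ∣ ≤⟨ ℤ.∣m⊝n∣≤m⊔n i j ⟩
    i ⊔ j         <⟨ ⊔-pres-<m i<r j<r ⟩
    r             ∎
    where open ≤-Reasoning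
  small-multiple : ∀ {t} → r ∣ t → t < r → t ≡ 0
  small-multiple {zero}  _   _   = refl
  small-multiple {suc t} r∣t t<r = contradiction r∣t (>⇒∤ t<r)
  ∣diff∣≡0 : ℤ.∣ + suc i ℤ.- + suc j ∣ ≡ 0
  ∣diff∣≡0 = small-multiple (ℤ∣.∣⇒∣ᵤ r∣diff) ∣diff∣<r

module Construction (n : ℕ) .{{_ : NonZero n}}
  (ω≤ : ∀ {r} → Prime r → r ∣ n → ω n ≤ r)
  (ω< : ∀ {r} → Prime r → r ^ 2 ∣ n → ω n < r) where

  rank : ℕ → ℕ
  rank = count (primeFactor? n)

  label : ℕ → ℕ → ℕ
  label d r = suc (rank (cyclicPred (primeFactor? d) (suc n) r))

  cofactor : ℕ → ℕ
  cofactor q = quotient (valuation-∣ q n)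

  term : ℕ → ℕ → ℤ
  term d q with primeFactor? d q
  ... | yes _ = + (cofactor q * q ^ pred (valuation q d) * label d q)
  ... | no  _ = 0ℤ

  residue : ℕ → ℤ
  residue d = ∑< (suc n) (term d)

  n≡cofactor*power : ∀ q → n ≡ cofactor q * q ^ valuation q n
  n≡cofactor*power q = m∣n⇒n≡quotient*m (valuation-∣ q n)

  cofactor-∤ : Prime r → ¬ r ∣ cofactor r
  cofactor-∤ {r} pr r∣W = valuation-∤ r {{prime⇒nonTrivial pr}} n
    (subst (r * r ^ valuation r n ∣_) (sym (n≡cofactor*power r)) (*-monoˡ-∣ (r ^ valuation r n) r∣W))

  power-∣-cofactor : Prime r → Prime q → r ≢ q → r ^ valuation r n ∣ cofactor q
  power-∣-cofactor {r} {q} pr pq r≢q =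
    prime-power-∣-cancel {j = valuation r n} {k = valuation q n} pr pq r≢q
    (subst (r ^ valuation r n ∣_) (trans (n≡cofactor*power q) (*-comm (cofactor q) _)) (valuation-∣ r n))

  term-of-primeFactor : PrimeFactor d r →
                        term d r ≡ + (cofactor r * r ^ pred (valuation r d) * label d r)
  term-of-primeFactor {d} {r} r∈d with primeFactor? d r
  ... | yes _   = refl
  ... | no  r∉d = contradiction r∈d r∉d

  power-∣-term : Prime r → q ≢ r → + (r ^ valuation r n) ℤ∣.∣ term d q
  power-∣-term {r} {q} {d} pr q≢r with primeFactor? d q
  ... | yes (pq , _) = ℤ∣.∣ᵤ⇒∣ (∣m⇒∣m*n _ (∣m⇒∣m*n _ (power-∣-cofactor pr pq (q≢r ∘ sym))))
  ... | no  _        = ℤ∣.divides 0ℤ refl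

  residue≡term : Prime r → r ∣ n → residue d ≡ term d r [mod r ^ valuation r n ]
  residue≡term pr r∣n = ∑<-≡-mod (s≤s (∣⇒≤ r∣n)) (λ _ q≢r → power-∣-term pr q≢r)

  primeFactor-< : d ∣ n → PrimeFactor d q → q < suc n
  primeFactor-< d∣n (_ , q∣d) = s≤s (∣⇒≤ (∣-trans q∣d d∣n))

  cyclicPred-primeFactor : d ∣ n → PrimeFactor d r →
                           PrimeFactor n (cyclicPred (primeFactor? d) (suc n) r)
  cyclicPred-primeFactor {d} {r} d∣n r∈d with cyclicPred-∈ (primeFactor? d) r∈d (primeFactor-< d∣n r∈d) r
  ... | pc , c∣d = pc , ∣-trans c∣d d∣n

  label≤ω : d ∣ n → PrimeFactor d r → label d r ≤ ω n
  label≤ω {d} {r} d∣n r∈d = begin-strict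
    rank (cyclicPred (primeFactor? d) (suc n) r)
      <⟨ count-< (primeFactor? n) c∈n (primeFactor-< ∣-refl c∈n) ⟩
    count (primeFactor? n) (suc n)
      ≡⟨ ω≡count n ≤-refl ⟨
    ω n ∎
    where
    open ≤-Reasoning
    c∈n : PrimeFactor n (cyclicPred (primeFactor? d) (suc n) r)
    c∈n = cyclicPred-primeFactor d∣n r∈d

  module _ {d d′} (d∣n : d ∣ n) (d′∣n : d′ ∣ n) (ov : Overlap (residue d) d (residue d′) d′)
           {r} (pr : Prime r) (r∣d : r ∣ d) (r∣d′ : r ∣ d′) where

    private instance
      r-nonTrivial : NonTrivial r
      r-nonTrivial = prime⇒nonTrivial pr
      d≢0 : NonZero d
      d≢0 = divisor-nonZero d∣n
      d′≢0 : NonZero d′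
      d′≢0 = divisor-nonZero d′∣n

    terms-congruent : valuation r d ≤ valuation r d′ → term d r ≡ term d′ r [mod r ^ valuation r d ]
    terms-congruent v≤v′ =
      ≡-mod-trans {x = term d r} {residue d} (≡-mod-sym {x = residue d} (reduce d∣n r∣d))
        (≡-mod-trans {x = residue d} {residue d′}
          (overlap⇒≡-mod ov (valuation-∣ r d) (∣-trans (^-∣-mono r v≤v′) (valuation-∣ r d′)))
          (reduce d′∣n r∣d′))
      where
      r^v∣r^e : r ^ valuation r d ∣ r ^ valuation r n
      r^v∣r^e = ^-∣-mono r (^∣⇒≤valuation {k = valuation r d} r (∣-trans (valuation-∣ r d) d∣n))
      reduce : ∀ {e} → e ∣ n → r ∣ e → residue e ≡ term e r [mod r ^ valuation r d ]
      reduce {e} e∣n r∣e =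
        ≡-mod-∣ {x = residue e} {term e r} r^v∣r^e (residue≡term {d = e} pr (∣-trans r∣e e∣n))

    labels-congruent : valuation r d ≤ valuation r d′ →
                       + label d r ≡ + (r ^ (valuation r d′ ∸ valuation r d) * label d′ r) [mod r ]
    labels-congruent v≤v′ = strip-power pr (cofactor-∤ pr) (∣⇒valuation>0 r r∣d) v≤v′
      (subst₂ (λ x y → x ≡ y [mod r ^ valuation r d ])
              (term-of-primeFactor (pr , r∣d)) (term-of-primeFactor (pr , r∣d′)) (terms-congruent v≤v′))

    valuation-≮ : ¬ valuation r d < valuation r d′
    valuation-≮ v<v′ = >⇒∤ label<r (ℤ∣.∣⇒∣ᵤ r∣label)
      where
      r²∣n : r ^ 2 ∣ n
      r²∣n = ∣-trans (^-∣-mono r (≤-trans (s≤s (∣⇒valuation>0 r r∣d)) v<v′))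
                     (∣-trans (valuation-∣ r d′) d′∣n)
      label<r : label d r < r
      label<r = ≤-<-trans (label≤ω d∣n (pr , r∣d)) (ω< pr r²∣n)
      r∣r^gap : r ∣ r ^ (valuation r d′ ∸ valuation r d)
      r∣r^gap = subst (_∣ r ^ (valuation r d′ ∸ valuation r d)) (*-identityʳ r)
                      (^-∣-mono r (m<n⇒0<n∸m v<v′))
      r∣shifted : + r ℤ∣.∣ + (r ^ (valuation r d′ ∸ valuation r d) * label d′ r)
      r∣shifted = ℤ∣.∣ᵤ⇒∣ (∣m⇒∣m*n (label d′ r) r∣r^gap)
      r∣label : + r ℤ∣.∣ + label d r
      r∣label = ℤ∣.∣m+n∣n⇒∣m (labels-congruent (<⇒≤ v<v′)) (ℤ∣.∣m⇒∣-m r∣shifted)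

    cyclicPred-≡ : valuation r d ≡ valuation r d′ →
                   cyclicPred (primeFactor? d) (suc n) r ≡ cyclicPred (primeFactor? d′) (suc n) r
    cyclicPred-≡ v≡v′ =
      count-injective (primeFactor? n) (cyclicPred-primeFactor d∣n (pr , r∣d))
                                       (cyclicPred-primeFactor d′∣n (pr , r∣d′))
        (suc-≡-mod⇒≡ (rank<r d∣n r∣d) (rank<r d′∣n r∣d′)
          (subst (λ t → + label d r ≡ + t [mod r ]) r^0*label≡label (labels-congruent (≤-reflexive v≡v′))))
      where
      rank<r : ∀ {e} → e ∣ n → r ∣ e → rank (cyclicPred (primeFactor? e) (suc n) r) < r
      rank<r e∣n r∣e = ≤-trans (label≤ω e∣n (pr , r∣e)) (ω≤ pr (∣-trans r∣e e∣n))
      gap≡0 : valuation r d′ ∸ valuation r d ≡ 0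
      gap≡0 = trans (cong (_∸ valuation r d) (sym v≡v′)) (n∸n≡0 (valuation r d))
      r^0*label≡label : r ^ (valuation r d′ ∸ valuation r d) * label d′ r ≡ label d′ r
      r^0*label≡label = trans (cong (λ t → r ^ t * label d′ r) gap≡0) (*-identityˡ (label d′ r))

  swap-overlap : ∀ {x x′ b b′} → Overlap x b x′ b′ → Overlap x′ b′ x b
  swap-overlap = Product.map₂ Product.swap

  valuation-≡ : d ∣ n → d′ ∣ n → Overlap (residue d) d (residue d′) d′ →
                Prime r → r ∣ d → r ∣ d′ → valuation r d ≡ valuation r d′
  valuation-≡ {d} {d′} {r} d∣n d′∣n ov pr r∣d r∣d′ with <-cmp (valuation r d) (valuation r d′)
  ... | tri< v<v′ _ _ = contradiction v<v′ (valuation-≮ d∣n d′∣n ov pr r∣d r∣d′)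
  ... | tri≈ _ v≡v′ _ = v≡v′
  ... | tri> _ _ v′<v = contradiction v′<v (valuation-≮ d′∣n d∣n (swap-overlap ov) pr r∣d′ r∣d)

  overlap⇒∣ : d ∣ n → d′ ∣ n → Overlap (residue d) d (residue d′) d′ →
              PrimeFactor d r → PrimeFactor d′ r → d ∣ d′
  overlap⇒∣ {d} {d′} d∣n d′∣n ov r∈d r∈d′ = ∣-by-valuations {{divisor-nonZero d∣n}} powers∣d′
    where
    agree : ∀ {q} → PrimeFactor d q → PrimeFactor d′ q →
            cyclicPred (primeFactor? d) (suc n) q ≡ cyclicPred (primeFactor? d′) (suc n) q
    agree (pq , q∣d) (_ , q∣d′) =
      cyclicPred-≡ d∣n d′∣n ov pq q∣d q∣d′ (valuation-≡ d∣n d′∣n ov pq q∣d q∣d′)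
    d⊆d′ : PrimeFactor d ⊆ PrimeFactor d′
    d⊆d′ = cyclicPred-≡⇒⊆ (primeFactor? d) (primeFactor? d′) (primeFactor-< d∣n) (primeFactor-< d′∣n)
                          agree r∈d r∈d′
    powers∣d′ : ∀ {q} → Prime q → q ∣ d → q ^ valuation q d ∣ d′
    powers∣d′ {q} pq q∣d with d⊆d′ (pq , q∣d)
    ... | _ , q∣d′ =
      subst (λ v → q ^ v ∣ d′) (sym (valuation-≡ d∣n d′∣n ov pq q∣d q∣d′)) (valuation-∣ q d′)

  nice : Nice n
  nice = residue , λ d d′ d∣n d′∣n _ _ → coprime d∣n d′∣n
    where
    coprime : d ∣ n → d′ ∣ n → d ≢ d′ → Overlap (residue d) d (residue d′) d′ → gcd d d′ ≡ 1
    coprime {d} {d′} d∣n d′∣n d≢d′ ov with gcd d d′ ≟ 1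
    ... | yes g≡1 = g≡1
    ... | no  g≢1 with common-prime-factor {{divisor-nonZero d∣n}} g≢1
    ...   | r , r∈d , r∈d′ = contradiction (∣-antisym (overlap⇒∣ d∣n d′∣n ov r∈d r∈d′)
                                                      (overlap⇒∣ d′∣n d∣n (swap-overlap ov) r∈d′ r∈d)) d≢d′

few-prime-factors⇒nice : ∀ n .{{_ : NonZero n}} →
                         (∀ {r} → Prime r → r ∣ n → ω n ≤ r) →
                         (∀ {r} → Prime r → r ^ 2 ∣ n → ω n < r) → Nice n
few-prime-factors⇒nice = Construction.nice

theorem2 : ∀ (n p m : ℕ) → 2 ≤ n → SmallestPrimeDivisor p n → n ≡ p * m →
           ω m < p → Nice n
theorem2 .(p * m) p m 2≤n (pp , _ , p-least) refl ω[m]<p = few-prime-factors⇒nice (p * m) ω≤ ω<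
  where
  instance
    n≢0 : NonZero (p * m)
    n≢0 = >-nonZero (<⇒≤ 2≤n)
    m≢0 : NonZero m
    m≢0 = m*n≢0⇒n≢0 p
  ω[n]≤p : ω (p * m) ≤ p
  ω[n]≤p = ≤-trans (ω[p*m]≤1+ω[m] m pp) ω[m]<p
  ω≤ : ∀ {r} → Prime r → r ∣ p * m → ω (p * m) ≤ r
  ω≤ {r} pr r∣n = ≤-trans ω[n]≤p (p-least r pr r∣n)
  ω< : ∀ {r} → Prime r → r ^ 2 ∣ p * m → ω (p * m) < r
  ω< {r} pr r²∣n with r ≟ p
  ... | no  r≢p = ≤-<-trans ω[n]≤p (≤∧≢⇒< (p-least r pr (∣-trans (m∣m*n (r * 1)) r²∣n)) (r≢p ∘ sym))
  ... | yes refl = ≤-<-trans (ω[p*m]≤ω[m] m pp p∣m) ω[m]<p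
    where
    p∣m : p ∣ m
    p∣m = subst (_∣ m) (*-identityʳ p) (*-cancelˡ-∣ p {{prime⇒nonZero pp}} r²∣n)
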